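{- Let $r\geqslant 1$, let $\mathrm{BF}(r)$ and $S^{(r)}$ be as in the context, and define $X_0=S^{(r)}$, \[X_k=X_{k-1}\cup\left\{(x,r-k): \{(x,r-k)\}=N(v)\setminus X_{k-1}\text{ for some }v=(y,r-k+1)\in X_{k-1}\right\}\quad(k=1,\dots,r),\] \[X_{r+k}=X_{r+k-1}\cup\left\{(x,k): \{(x,k)\}=N(v)\setminus X_{r+k-1}\text{ for some }v=(y,k-1)\in X_{r+k-1}\right\}\quad(k=1,\dots,r).\] Write $X_m(i)=X_m\cap V_i$. Then for every $k\in\{0,1,\dots,r\}$, \[X_{r+k}(i)=\begin{cases}V_i & \text{for } i\in\{0,\dots,k\},\\ X_r(i) & \text{for } i\in\{k+1,\dots,r\}.\end{cases}\]
   Context: $(J_n)$ is the Jacobsthal sequence: $J_0=0$, $J_1=1$, $J_n=J_{n-1}+2J_{n-2}$. The butterfly network $\mathrm{BF}(r)$ has vertex set $\bigcup_{i=0}^r V_i$ with $V_i=\{(x,i): x\in\{0,\dots,2^r-1\}\}$, each $x$ identified with the binary vector $(x_1,\dots,x_r)$ with $x=\sum_j x_j2^{j-1}$; edges join $(x,i-1)$ and $(y,i)$ for $1\leqslant i\leqslant r$ and $y\in\{x,x+e_i\}$ (addition modulo 2, $e_i$ the $i$-th unit vector). $N(v)$ denotes the set of neighbors of $v$. $S^{(r)}=S_0\cup\cdots\cup S_r$ with $S_i=\{(x,i): 2^{i+1}\ell\leqslant x\leqslant 2^{i+1}\ell+J_{i+1}-1 \text{ for some integer }\ell\}$ for $i=0,\dots,r-1$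 and $S_r=\{(x,r): 0\leqslant x\leqslant J_{r+1}-1\}$. -}

module Defs where

open import Data.Nat using (ℕ; zero; suc; _+_; _*_; _∸_; _^_; _≤_; _<_)
open import Data.Nat.DivMod using (_/_; _%_)
open import Data.Product using (Σ; ∃; _×_; _,_)
open import Data.Sum using (_⊎_)
open import Relation.Nullary using (¬_)
open import Relation.Binary.PropositionalEquality using (_≡_)

J : ℕ → ℕ
J zero = 0
J (suc zero) = 1
J (suc (suc n)) = J (suc n) + 2 * J n

-- j-th binary digit x_j of x (1-indexed): x = Σ_j x_j 2^(j-1)
-- (computed as the last binary digit of x halved (j-1) times)
half : ℕ → ℕ
half x = x / 2

bit : ℕ → ℕ → ℕ
bit x zero = x % 2
bit x (suc zero) = x % 2
bit x (suc (suc j)) = bit (half x) (suc j)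

-- x + e_i (mod 2): flip the i-th binary digit of x (i ≥ 1)
flipBit : ℕ → ℕ → ℕ
flipBit x i with bit x i
... | zero = x + 2 ^ (i ∸ 1)
... | suc _ = x ∸ 2 ^ (i ∸ 1)

-- vertices of BF(r) are pairs (x , i) with x < 2^r and i ≤ r
Vertex : Set
Vertex = ℕ × ℕ

Pred : Set₁
Pred = Vertex → Set

V : ℕ → ℕ → Pred
V r i (x , j) = (j ≡ i) × (x < 2 ^ r)

Edge : ℕ → Vertex → Vertex → Set
Edge r (x , i₀) (y , i) =
  (suc i₀ ≡ i) × (i ≤ r) × (x < 2 ^ r) × (y < 2 ^ r) × ((y ≡ x) ⊎ (y ≡ flipBit x i))

Adj : ℕ → Vertex → Vertex → Set
Adj r u v = Edge r u v ⊎ Edge r v u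

N : ℕ → Vertex → Pred
N r v u = Adj r v u

S : ℕ → Pred
S r (x , i) =
  (x < 2 ^ r) × (i ≤ r) ×
  (((i < r) × (∃ λ ℓ → (2 ^ (suc i) * ℓ ≤ x) × (x < 2 ^ (suc i) * ℓ + J (suc i))))
   ⊎ ((i ≡ r) × (x < J (suc r))))

NewAt : ℕ → Pred → ℕ → ℕ → Pred
NewAt r X t s (x , j) =
  (j ≡ t) × ∃ λ y → X (y , s) ×
    (N r (y , s) (x , t) × ¬ X (x , t) ×
     (∀ u → N r (y , s) u → ¬ X u → u ≡ (x , t)))

-- first phase: Xdown k = X_k for k = 0..r
Xdown : ℕ → ℕ → Pred
Xdown r zero p = S r p
Xdown r (suc k) p = Xdown r k p ⊎ NewAt r (Xdown r k) (r ∸ suc k) (r ∸ k) p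

-- second phase: Xup k = X_{r+k} for k = 0..r
Xup : ℕ → ℕ → Pred
Xup r zero p = Xdown r r p
Xup r (suc k) p = Xup r k p ⊎ NewAt r (Xup r k) (suc k) k p

module Submission where

-- Write low j x = x mod 2^j and call x good at level j when low j x < J (j+1).  The heart
-- of the proof is the description of X_r: (x , i) ∈ X_r iff x is good at level i.
-- Three digit facts drive it: flipping bit j+1 does not change low j; one of x, x + e_(j+1)
-- has bit j+1 equal to 0; and S_i consists of the x with low (i+1) x < J (i+1).
-- Soundness: a vertex forced from (y , t+1) down to (x , t) has its partner x + e_(t+1) in X,
-- which is good and has the same low t.  Completeness: step k reaches level i = r - k; a good
-- x with bit i+1 equal to 0 is already in S_i, and one with bit i+1 equal to 1 is forced by
-- (x + e_(i+1) , i+1), whose other neighbours lie in S_i or are good on level i+2.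
-- In the second phase, step k+1 fills level k+1: a vertex that is not good is forced from
-- (x , k), since x + e_(k+1) is good (2^k ≤ J (k+2)) and level k is already full.

open import Defs
open import Data.Nat using (ℕ; _≤_; _<_; _^_)
open import Data.Product using (_×_; _,_)
open import Function.Bundles using (_⇔_)

open import Data.Nat using (zero; suc; _+_; _*_; _∸_; z≤n; s≤s; NonZero; _≤?_; _<?_)
open import Data.Nat.Properties
open import Data.Nat.DivMod
open import Data.Nat.Divisibility using (divides)
open import Data.Nat.Tactic.RingSolver using (solve-∀)
open import Data.Product using (proj₁; proj₂)
open import Data.Sum using (_⊎_; inj₁; inj₂; [_,_]′) renaming (map to ⊎-map)
open import Data.Empty using (⊥-elim)
open import Function.Bundles using (mk⇔)
open import Relation.Nullary using (¬_; yes; no; Dec; contradiction)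
open import Relation.Nullary.Decidable using (decidable-stable)
open import Relation.Binary.PropositionalEquality hiding (J)

mod-unique : ∀ {m n} k .{{_ : NonZero n}} → m < n → (m + k * n) % n ≡ m
mod-unique {m} {n} k m<n = trans ([m+kn]%n≡m%n m k n) (m<n⇒m%n≡m m<n)

div-unique : ∀ {m n} k .{{_ : NonZero n}} → m < n → (m + k * n) / n ≡ k
div-unique {m} {n} k m<n = begin
  (m + k * n) / n    ≡⟨ +-distrib-/-∣ʳ m (divides k refl) ⟩
  m / n + k * n / n  ≡⟨ cong₂ _+_ (m<n⇒m/n≡0 m<n) (m*n/n≡m k n) ⟩
  k                  ∎
  where open ≡-Reasoning

block-< : ∀ {q a a' K N} → a < N → q * N + a' < K * N → q * N + a < K * N
block-< {q} {a} {a'} {K} {N} a<N qNa'<KN with K ≤? q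
... | yes K≤q = contradiction (≤-trans (*-monoˡ-≤ N K≤q) (m≤m+n (q * N) a')) (<⇒≱ qNa'<KN)
... | no K≰q = begin-strict
  q * N + a   <⟨ +-monoʳ-< (q * N) a<N ⟩
  q * N + N   ≡⟨ +-comm (q * N) N ⟩
  suc q * N   ≤⟨ *-monoˡ-≤ N (≰⇒> K≰q) ⟩
  K * N       ∎
  where open ≤-Reasoning

window→ : ∀ {n c ℓ x} .{{_ : NonZero n}} → c ≤ n → n * ℓ ≤ x → x < n * ℓ + c → x % n < c
window→ {n} {c} {ℓ} {x} c≤n nℓ≤x x< = subst (_< c) (sym x%n≡d) d<c
  where
    d = x ∸ n * ℓ
    x≡ : x ≡ n * ℓ + d
    x≡ = sym (m+[n∸m]≡n nℓ≤x)
    d<c : d < c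
    d<c = +-cancelˡ-< (n * ℓ) d c (subst (_< n * ℓ + c) x≡ x<)
    x%n≡d : x % n ≡ d
    x%n≡d = trans (cong (_% n) (trans x≡ (trans (+-comm (n * ℓ) d) (cong (d +_) (*-comm n ℓ)))))
                  (mod-unique ℓ (<-≤-trans d<c c≤n))

window← : ∀ {n c x} .{{_ : NonZero n}} → x % n < c → n * (x / n) ≤ x × x < n * (x / n) + c
window← {n} {c} {x} x%n<c =
    subst (_≤ x) (*-comm (x / n) n) (m/n*n≤m x n)
  , subst₂ _<_ (sym x≡) (+-comm c _) (+-monoˡ-< (n * (x / n)) x%n<c)
  where
    x≡ : x ≡ x % n + n * (x / n)
    x≡ = trans (m≡m%n+[m/n]*n x n) (cong (x % n +_) (*-comm (x / n) n))

bit-as-div : ∀ j x → bit x (suc j) ≡ (_/_ x (2 ^ j) {{m^n≢0 2 j}}) % 2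
bit-as-div zero x = cong (_% 2) (sym (n/1≡n x))
bit-as-div (suc j) x = trans (bit-as-div j (x / 2))
  (cong (_% 2) (m/n/o≡m/[n*o] x 2 (2 ^ j) {{_}} {{m^n≢0 2 j}} {{m^n≢0 2 (suc j)}}))

flipBit-0 : ∀ x i → bit x i ≡ 0 → flipBit x i ≡ x + 2 ^ (i ∸ 1)
flipBit-0 x i b≡0 with bit x i
flipBit-0 x i refl | zero = refl

flipBit-1 : ∀ x i → bit x i ≡ 1 → flipBit x i ≡ x ∸ 2 ^ (i ∸ 1)
flipBit-1 x i b≡1 with bit x i
flipBit-1 x i refl | suc _ = refl

bin : ℕ → ℕ → ℕ → ℕ → ℕ
bin j q b m = q * 2 ^ suc j + b * 2 ^ j + m

low : ℕ → ℕ → ℕ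
low j x = _%_ x (2 ^ j) {{m^n≢0 2 j}}

module BitPosition (j : ℕ) where
  private instance
    2^j≢0 : NonZero (2 ^ j)
    2^j≢0 = m^n≢0 2 j
    2^1+j≢0 : NonZero (2 ^ suc j)
    2^1+j≢0 = m^n≢0 2 (suc j)

  bin-low : ∀ q b m → bin j q b m ≡ m + (q * 2 + b) * 2 ^ j
  bin-low q b m = shape q b m (2 ^ j)
    where shape : ∀ q b m P → q * (2 * P) + b * P + m ≡ m + (q * 2 + b) * P
          shape = solve-∀

  bin-high : ∀ q b m → bin j q b m ≡ (b * 2 ^ j + m) + q * 2 ^ suc j
  bin-high q b m = shape q b m (2 ^ j)
    where shape : ∀ q b m P → q * (2 * P) + b * P + m ≡ (b * P + m) + q * (2 * P)
          shape = solve-∀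

  bin-step : ∀ q m → bin j q 0 m + 2 ^ j ≡ bin j q 1 m
  bin-step q m = shape q m (2 ^ j)
    where shape : ∀ q m P → q * (2 * P) + 0 * P + m + P ≡ q * (2 * P) + 1 * P + m
          shape = solve-∀

  bin0<bin1 : ∀ q m → bin j q 0 m < bin j q 1 m
  bin0<bin1 q m = subst (bin j q 0 m <_) (bin-step q m) (m<m+n _ (m^n>0 2 j))

  low-part< : ∀ {b m} → b < 2 → m < 2 ^ j → b * 2 ^ j + m < 2 ^ suc j
  low-part< b<2 m< = +-mono-≤-< (weight b<2) (m≤n⇒m≤n+o 0 m<)
    where weight : ∀ {b} → b < 2 → b * 2 ^ j ≤ 2 ^ j
          weight {zero} _ = z≤n
          weight {suc zero} _ = ≤-reflexive (+-identityʳ _)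
          weight {suc (suc _)} (s≤s (s≤s ()))

  low-bin : ∀ q b {m} → m < 2 ^ j → low j (bin j q b m) ≡ m
  low-bin q b {m} m< = trans (cong (_% 2 ^ j) (bin-low q b m)) (mod-unique (q * 2 + b) m<)

  low-suc-bin : ∀ q {b m} → b < 2 → m < 2 ^ j → low (suc j) (bin j q b m) ≡ b * 2 ^ j + m
  low-suc-bin q {b} {m} b<2 m< =
    trans (cong (_% 2 ^ suc j) (bin-high q b m)) (mod-unique q (low-part< b<2 m<))

  bit-bin : ∀ q b {m} → b < 2 → m < 2 ^ j → bit (bin j q b m) (suc j) ≡ b
  bit-bin q b {m} b<2 m< = begin
    bit (bin j q b m) (suc j)             ≡⟨ bit-as-div j _ ⟩
    bin j q b m / 2 ^ j % 2               ≡⟨ cong (λ z → z / 2 ^ j % 2) (bin-low q b m) ⟩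
    (m + (q * 2 + b) * 2 ^ j) / 2 ^ j % 2 ≡⟨ cong (_% 2) (div-unique (q * 2 + b) m<) ⟩
    (q * 2 + b) % 2                       ≡⟨ cong (_% 2) (+-comm (q * 2) b) ⟩
    (b + q * 2) % 2                       ≡⟨ mod-unique q b<2 ⟩
    b                                     ∎
    where open ≡-Reasoning

  flip-bin0 : ∀ q {m} → m < 2 ^ j → flipBit (bin j q 0 m) (suc j) ≡ bin j q 1 m
  flip-bin0 q m< = trans (flipBit-0 _ (suc j) (bit-bin q 0 (s≤s z≤n) m<)) (bin-step q _)

  flip-bin1 : ∀ q {m} → m < 2 ^ j → flipBit (bin j q 1 m) (suc j) ≡ bin j q 0 m
  flip-bin1 q {m} m< = begin
    flipBit (bin j q 1 m) (suc j)   ≡⟨ flipBit-1 _ (suc j) (bit-bin q 1 (s≤s (s≤s z≤n)) m<) ⟩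
    bin j q 1 m ∸ 2 ^ j             ≡⟨ cong (_∸ 2 ^ j) (sym (bin-step q m)) ⟩
    bin j q 0 m + 2 ^ j ∸ 2 ^ j     ≡⟨ m+n∸n≡m _ (2 ^ j) ⟩
    bin j q 0 m                     ∎
    where open ≡-Reasoning

  data BitView : ℕ → Set where
    bit0 : ∀ q {m} → m < 2 ^ j → BitView (bin j q 0 m)
    bit1 : ∀ q {m} → m < 2 ^ j → BitView (bin j q 1 m)

  bitView : ∀ x → BitView x
  bitView x with x % 2 ^ suc j <? 2 ^ j
  ... | yes R< = subst BitView (sym x≡) (bit0 Q R<)
    where
      Q = x / 2 ^ suc j
      shape : ∀ R Q P → R + Q * (2 * P) ≡ Q * (2 * P) + 0 * P + R
      shape = solve-∀
      x≡ : x ≡ bin j Q 0 (x % 2 ^ suc j)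
      x≡ = trans (m≡m%n+[m/n]*n x (2 ^ suc j)) (shape _ Q (2 ^ j))
  ... | no R≮ = subst BitView (sym x≡) (bit1 Q R'<)
    where
      Q = x / 2 ^ suc j
      R = x % 2 ^ suc j
      R' = R ∸ 2 ^ j
      R'< : R' < 2 ^ j
      R'< = m<n+o⇒m∸n<o R (2 ^ j)
              (subst (R <_) (cong (2 ^ j +_) (+-identityʳ (2 ^ j))) (m%n<n x (2 ^ suc j)))
      shape : ∀ R' Q P → (P + R') + Q * (2 * P) ≡ Q * (2 * P) + 1 * P + R'
      shape = solve-∀
      x≡ : x ≡ bin j Q 1 R'
      x≡ = begin
        x                            ≡⟨ m≡m%n+[m/n]*n x (2 ^ suc j) ⟩
        R + Q * 2 ^ suc j            ≡⟨ cong (_+ Q * 2 ^ suc j) (sym (m+[n∸m]≡n (≮⇒≥ R≮))) ⟩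
        (2 ^ j + R') + Q * 2 ^ suc j ≡⟨ shape R' Q (2 ^ j) ⟩
        bin j Q 1 R'                 ∎
        where open ≡-Reasoning

  flip-involutive : ∀ x → flipBit (flipBit x (suc j)) (suc j) ≡ x
  flip-involutive x with bitView x
  ... | bit0 q m< = trans (cong (λ z → flipBit z (suc j)) (flip-bin0 q m<)) (flip-bin1 q m<)
  ... | bit1 q m< = trans (cong (λ z → flipBit z (suc j)) (flip-bin1 q m<)) (flip-bin0 q m<)

  flip-≢ : ∀ x → flipBit x (suc j) ≢ x
  flip-≢ x with bitView x
  ... | bit0 q {m} m< = λ eq → <-irrefl (trans (sym eq) (flip-bin0 q m<)) (bin0<bin1 q m)
  ... | bit1 q {m} m< = λ eq → <-irrefl (trans (sym (flip-bin1 q m<)) eq) (bin0<bin1 q m)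

  flip-< : ∀ r x → suc j ≤ r → x < 2 ^ r → flipBit x (suc j) < 2 ^ r
  flip-< r x sj≤r x< with bitView x
  ... | bit1 q {m} m< = subst (_< 2 ^ r) (sym (flip-bin1 q m<)) (<-trans (bin0<bin1 q m) x<)
  ... | bit0 q {m} m< = subst₂ _<_ (sym (trans (flip-bin0 q m<) (bin-block 1 m))) (sym 2^r≡)
          (block-< {q = q} {K = 2 ^ (r ∸ suc j)} (low-part< (s≤s (s≤s z≤n)) m<)
            (subst₂ _<_ (bin-block 0 m) 2^r≡ x<))
    where
      bin-block : ∀ b m → bin j q b m ≡ q * 2 ^ suc j + (b * 2 ^ j + m)
      bin-block b m = +-assoc (q * 2 ^ suc j) (b * 2 ^ j) m
      2^r≡ : 2 ^ r ≡ 2 ^ (r ∸ suc j) * 2 ^ suc j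
      2^r≡ = begin
        2 ^ r                          ≡⟨ cong (2 ^_) (sym (m+[n∸m]≡n sj≤r)) ⟩
        2 ^ (suc j + (r ∸ suc j))      ≡⟨ ^-distribˡ-+-* 2 (suc j) (r ∸ suc j) ⟩
        2 ^ suc j * 2 ^ (r ∸ suc j)    ≡⟨ *-comm (2 ^ suc j) _ ⟩
        2 ^ (r ∸ suc j) * 2 ^ suc j    ∎
        where open ≡-Reasoning

  low-flip : ∀ x → low j (flipBit x (suc j)) ≡ low j x
  low-flip x with bitView x
  ... | bit0 q m< = trans (cong (low j) (flip-bin0 q m<)) (trans (low-bin q 1 m<) (sym (low-bin q 0 m<)))
  ... | bit1 q m< = trans (cong (low j) (flip-bin1 q m<)) (trans (low-bin q 0 m<) (sym (low-bin q 1 m<)))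

  low-suc : ∀ x → (low (suc j) x ≡ low j x) ⊎ (low (suc j) x ≡ 2 ^ j + low j x)
  low-suc x with bitView x
  ... | bit0 q m< = inj₁ (trans (low-suc-bin q (s≤s z≤n) m<) (sym (low-bin q 0 m<)))
  ... | bit1 q {m} m< = inj₂ (begin
    low (suc j) (bin j q 1 m)   ≡⟨ low-suc-bin q (s≤s (s≤s z≤n)) m< ⟩
    1 * 2 ^ j + m               ≡⟨ cong (_+ m) (*-identityˡ (2 ^ j)) ⟩
    2 ^ j + m                   ≡⟨ cong (2 ^ j +_) (sym (low-bin q 1 m<)) ⟩
    2 ^ j + low j (bin j q 1 m) ∎)
    where open ≡-Reasoning

  -- One of x and x + e_(j+1) has digit j+1 equal to 0, so its last j+1 digits equal low j x.
  low-bit0-side : ∀ x → low (suc j) x ≡ low j x ⊎ low (suc j) (flipBit x (suc j)) ≡ low j x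
  low-bit0-side x with bitView x
  ... | bit0 q m< = inj₁ (trans (low-suc-bin q (s≤s z≤n) m<) (sym (low-bin q 0 m<)))
  ... | bit1 q m< = inj₂ (begin
    low (suc j) (flipBit (bin j q 1 _) (suc j)) ≡⟨ cong (low (suc j)) (flip-bin1 q m<) ⟩
    low (suc j) (bin j q 0 _)                   ≡⟨ low-suc-bin q (s≤s z≤n) m< ⟩
    _                                           ≡⟨ sym (low-bin q 1 m<) ⟩
    low j (bin j q 1 _)                         ∎)
    where open ≡-Reasoning

open BitPosition

J-sum : ∀ n → J n + J (suc n) ≡ 2 ^ n
J-sum zero = refl
J-sum (suc n) = trans (shape (J n) (J (suc n))) (cong (2 *_) (J-sum n))
  where shape : ∀ a b → b + (b + 2 * a) ≡ 2 * (a + b)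
        shape = solve-∀

J≤2^ : ∀ i → J (suc i) ≤ 2 ^ i
J≤2^ i = subst (J (suc i) ≤_) (J-sum i) (m≤n+m (J (suc i)) (J i))

J≤2^suc : ∀ i → J (suc i) ≤ 2 ^ suc i
J≤2^suc i = ≤-trans (J≤2^ i) (m≤m+n (2 ^ i) (2 ^ i + 0))

2^≤J : ∀ i → 2 ^ i ≤ J (suc (suc i))
2^≤J i = subst (_≤ J (suc (suc i))) (trans (+-comm (J (suc i)) (J i)) (J-sum i))
           (+-monoʳ-≤ (J (suc i)) (m≤m+n (J i) (J i + 0)))

J-mono : ∀ i → J (suc i) ≤ J (suc (suc i))
J-mono i = m≤m+n _ _

J-shift : ∀ i → J (suc (suc (suc i))) ≡ 2 ^ suc i + J (suc i)
J-shift i = trans (shape (J (suc i)) (J (suc (suc i)))) (cong (_+ J (suc i)) (J-sum (suc i)))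
  where shape : ∀ a b → b + 2 * a ≡ (a + b) + a
        shape = solve-∀

-- x is good at level j when its last j digits are below J (j+1); these are the x with
-- (x , j) ∈ X_r.
Good : ℕ → ℕ → Set
Good j x = low j x < J (suc j)

-- The condition defining S_i (for i < r): the last i+1 digits are below J (i+1).
Seed : ℕ → ℕ → Set
Seed i x = low (suc i) x < J (suc i)

good? : ∀ j x → Dec (Good j x)
good? j x = low j x <? J (suc j)

good-zero : ∀ x → Good 0 x
good-zero x = subst (_< 1) (sym (n%1≡0 x)) (s≤s z≤n)

good-unflip : ∀ j x → Good j (flipBit x (suc j)) → Good j x
good-unflip j x g = subst (_< J (suc j)) (low-flip j x) g

good-or-flip-good : ∀ j x → Good (suc j) x ⊎ Good (suc j) (flipBit x (suc j))
good-or-flip-good j x = ⊎-map below below (low-bit0-side j x)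
  where
    below : ∀ {y} → y ≡ low j x → y < J (suc (suc j))
    below refl = <-≤-trans (m%n<n x (2 ^ j) {{m^n≢0 2 j}}) (2^≤J j)

seed⇒good : ∀ i x → Seed i x → Good i x
seed⇒good i x s = ≤-<-trans low≤ s
  where
    low≤ : low i x ≤ low (suc i) x
    low≤ with low-suc i x
    ... | inj₁ eq = ≤-reflexive (sym eq)
    ... | inj₂ eq = ≤-trans (m≤n+m _ (2 ^ i)) (≤-reflexive (sym eq))

seed⇒good-suc : ∀ i x → Seed i x → Good (suc i) x
seed⇒good-suc i x s = <-≤-trans s (J-mono i)

seed⇒good-suc-suc : ∀ i x → Seed i x → Good (suc (suc i)) x
seed⇒good-suc-suc i x s = begin-strict
  low (suc (suc i)) x       ≤⟨ low≤ ⟩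
  2 ^ suc i + low (suc i) x <⟨ +-monoʳ-< (2 ^ suc i) s ⟩
  2 ^ suc i + J (suc i)     ≡⟨ sym (J-shift i) ⟩
  J (suc (suc (suc i)))     ∎
  where
    open ≤-Reasoning
    low≤ : low (suc (suc i)) x ≤ 2 ^ suc i + low (suc i) x
    low≤ with low-suc (suc i) x
    ... | inj₁ eq = ≤-trans (≤-reflexive eq) (m≤n+m _ (2 ^ suc i))
    ... | inj₂ eq = ≤-reflexive eq

seed-flip : ∀ i x → Seed i x → Seed i (flipBit x (suc (suc i)))
seed-flip i x s = subst (_< J (suc i)) (sym (low-flip (suc i) x)) s

good⇒seed-or-flip-seed : ∀ i x → Good i x →
  Seed i x ⊎ (¬ Seed i x × Seed i (flipBit x (suc i)))
good⇒seed-or-flip-seed i x g with bitView i x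
... | bit0 q {m} m< = inj₁ (subst (_< J (suc i)) (sym low≡) g)
  where low≡ : low (suc i) (bin i q 0 m) ≡ low i (bin i q 0 m)
        low≡ = trans (low-suc-bin i q (s≤s z≤n) m<) (sym (low-bin i q 0 m<))
... | bit1 q {m} m< = inj₂ (not-seed , flip-seed)
  where
    not-seed : ¬ Seed i (bin i q 1 m)
    not-seed s = <⇒≱ s (begin
      J (suc i)                   ≤⟨ J≤2^ i ⟩
      2 ^ i                       ≤⟨ m≤m+n (2 ^ i) m ⟩
      2 ^ i + m                   ≡⟨ cong (_+ m) (sym (*-identityˡ (2 ^ i))) ⟩
      1 * 2 ^ i + m               ≡⟨ sym (low-suc-bin i q (s≤s (s≤s z≤n)) m<) ⟩
      low (suc i) (bin i q 1 m)   ∎)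
      where open ≤-Reasoning
    flip-seed : Seed i (flipBit (bin i q 1 m) (suc i))
    flip-seed = subst (_< J (suc i)) (sym low≡) g
      where low≡ : low (suc i) (flipBit (bin i q 1 m) (suc i)) ≡ low i (bin i q 1 m)
            low≡ = trans (cong (low (suc i)) (flip-bin1 i q m<))
                     (trans (low-suc-bin i q (s≤s z≤n) m<) (sym (low-bin i q 1 m<)))

module Forcing (r : ℕ) where

  S-seed : ∀ {i x} → i < r → S r (x , i) → Seed i x
  S-seed {i} i<r (_ , _ , inj₁ (_ , ℓ , le , lt)) = window→ {{m^n≢0 2 (suc i)}} (J≤2^suc i) le lt
  S-seed i<r (_ , _ , inj₂ (refl , _)) = ⊥-elim (<-irrefl refl i<r)

  seed-S : ∀ {i x} → i < r → x < 2 ^ r → Seed i x → S r (x , i)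
  seed-S {i} i<r x< s = x< , <⇒≤ i<r , inj₁ (i<r , _ , window← {{m^n≢0 2 (suc i)}} s)

  S-good : ∀ {i x} → S r (x , i) → Good i x
  S-good {i} {x} S@(_ , _ , inj₁ (i<r , _)) = seed⇒good i x (S-seed i<r S)
  S-good {x = x} (_ , _ , inj₂ (refl , x<J)) = ≤-<-trans (m%n≤m x (2 ^ r) {{m^n≢0 2 r}}) x<J

  good-S-top : ∀ {x} → x < 2 ^ r → Good r x → S r (x , r)
  good-S-top x< g = x< , ≤-refl , inj₂ (refl , subst (_< J (suc r)) (m<n⇒m%n≡m {{m^n≢0 2 r}} x<) g)

  S⊆Xdown : ∀ k {p} → S r p → Xdown r k p
  S⊆Xdown zero s = s
  S⊆Xdown (suc k) s = inj₁ (S⊆Xdown k s)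

  Xdown-below : ∀ k {i x} → i + k < r → Xdown r k (x , i) → S r (x , i)
  Xdown-below zero _ s = s
  Xdown-below (suc k) {i} i+k<r (inj₁ h) = Xdown-below k (<-trans (+-monoʳ-< i (n<1+n k)) i+k<r) h
  Xdown-below (suc k) {i} i+k<r (inj₂ (refl , _)) = ⊥-elim (<-irrefl level≡ i+k<r)
    where level≡ : r ∸ suc k + suc k ≡ r
          level≡ = m∸n+n≡m (≤-trans (m≤n+m (suc k) i) (<⇒≤ i+k<r))

  NewAt-bounded : ∀ {X t s x j} → NewAt r X t s (x , j) → x < 2 ^ r
  NewAt-bounded (_ , _ , _ , inj₁ (_ , _ , _ , x< , _) , _) = x<
  NewAt-bounded (_ , _ , _ , inj₂ (_ , _ , x< , _ , _) , _) = x<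

  Xdown-bounded : ∀ k {x i} → Xdown r k (x , i) → x < 2 ^ r
  Xdown-bounded zero s = proj₁ s
  Xdown-bounded (suc k) (inj₁ h) = Xdown-bounded k h
  Xdown-bounded (suc k) (inj₂ h) = NewAt-bounded h

  Xup-bounded : ∀ k {x i} → Xup r k (x , i) → x < 2 ^ r
  Xup-bounded zero h = Xdown-bounded r h
  Xup-bounded (suc k) (inj₁ h) = Xup-bounded k h
  Xup-bounded (suc k) (inj₂ h) = NewAt-bounded h

  Xdown⊆Xup : ∀ k {p} → Xdown r r p → Xup r k p
  Xdown⊆Xup zero h = h
  Xdown⊆Xup (suc k) h = inj₁ (Xdown⊆Xup k h)

  Xup-above : ∀ k {x i} → k < i → Xup r k (x , i) → Xdown r r (x , i)
  Xup-above zero _ h = h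
  Xup-above (suc k) k<i (inj₁ h) = Xup-above k (<-trans (n<1+n k) k<i) h
  Xup-above (suc k) k<i (inj₂ (refl , _)) = ⊥-elim (<-irrefl refl k<i)

  -- Forcing downwards preserves goodness: the partner x + e_(t+1) of a forced vertex (x , t)
  -- is a neighbour of the same forcing vertex, hence already in X, hence good.
  new-good : ∀ {X t x j} → (∀ {z} → X (z , t) → Good t z) → NewAt r X t (suc t) (x , j) → Good j x
  new-good _ (refl , _ , _ , inj₁ (ssj≡j , _) , _) = ⊥-elim (ssn≢n ssj≡j)
    where ssn≢n : ∀ {n} → suc (suc n) ≢ n
          ssn≢n ()
  new-good {X} {t} {x} X-good (refl , y , _ , inj₂ (_ , st≤r , x< , y< , y≈x) , _ , unique) =
    decidable-stable (good? t x) λ ¬good → o-not-out (λ o-in → ¬good (good-unflip t x (X-good o-in)))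
    where
      o = flipBit x (suc t)
      y≈o : y ≡ o ⊎ y ≡ flipBit o (suc t)
      y≈o = [ (λ y≡x → inj₂ (trans y≡x (sym (flip-involutive t x)))) , inj₁ ]′ y≈x
      o-not-out : ¬ ¬ X (o , t)
      o-not-out o-out = flip-≢ t x (cong proj₁
        (unique (o , t) (inj₂ (refl , st≤r , flip-< t r x st≤r x< , y< , y≈o)) o-out))

  source-level : ∀ {k} → suc k ≤ r → r ∸ k ≡ suc (r ∸ suc k)
  source-level sk≤r = +-∸-assoc 1 sk≤r

  Xdown-good : ∀ k → k ≤ r → ∀ {x i} → Xdown r k (x , i) → Good i x
  Xdown-good zero _ s = S-good s
  Xdown-good (suc k) sk≤r (inj₁ h) = Xdown-good k (≤-trans (n≤1+n k) sk≤r) h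
  Xdown-good (suc k) sk≤r {x} {i} (inj₂ h) =
    new-good (Xdown-good k (≤-trans (n≤1+n k) sk≤r))
      (subst (λ s → NewAt r (Xdown r k) (r ∸ suc k) s (x , i)) (source-level sk≤r) h)

  Covers : ℕ → Set
  Covers k = ∀ {i x} → r ≤ i + k → i ≤ r → x < 2 ^ r → Good i x → Xdown r k (x , i)

  -- On the level i = r - (k+1), a vertex outside S_i whose partner x + e_(i+1) lies in S_i is
  -- forced by (x + e_(i+1) , i+1): its other neighbours lie in S_i or are good on level i+2.
  forced : ∀ k i {x} → i + suc k ≡ r → Covers k → x < 2 ^ r →
           ¬ Seed i x → Seed i (flipBit x (suc i)) → NewAt r (Xdown r k) i (suc i) (x , i)
  forced k i {x} i+sk≡r covers x< x-not-seed y-seed = refl , y , y-in , adj , x-out , unique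
    where
      y = flipBit x (suc i)
      r≤ : r ≤ suc i + k
      r≤ = ≤-reflexive (trans (sym i+sk≡r) (+-suc i k))
      i+k<r : i + k < r
      i+k<r = ≤-reflexive (trans (sym (+-suc i k)) i+sk≡r)
      si≤r : suc i ≤ r
      si≤r = ≤-trans (s≤s (m≤m+n i k)) i+k<r
      y< : y < 2 ^ r
      y< = flip-< i r x si≤r x<
      y-in : Xdown r k (y , suc i)
      y-in = covers r≤ si≤r y< (seed⇒good-suc i y y-seed)
      adj : N r (y , suc i) (x , i)
      adj = inj₂ (refl , si≤r , x< , y< , inj₂ refl)
      x-out : ¬ Xdown r k (x , i)
      x-out h = x-not-seed (S-seed si≤r (Xdown-below k i+k<r h))
      y-low-in : Xdown r k (y , i)
      y-low-in = S⊆Xdown k (seed-S si≤r y< y-seed)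
      up-seed : ∀ {a} → a ≡ y ⊎ a ≡ flipBit y (suc (suc i)) → Seed i a
      up-seed (inj₁ refl) = y-seed
      up-seed (inj₂ refl) = seed-flip i y y-seed
      unique : ∀ u → N r (y , suc i) u → ¬ Xdown r k u → u ≡ (x , i)
      unique (a , _) (inj₁ (refl , j≤r , _ , a< , a≈y)) a-out =
        ⊥-elim (a-out (covers (≤-trans r≤ (n≤1+n _)) j≤r a< (seed⇒good-suc-suc i a (up-seed a≈y))))
      unique (a , _) (inj₂ (refl , _ , _ , _ , inj₁ y≡a)) a-out =
        ⊥-elim (a-out (subst (λ z → Xdown r k (z , i)) y≡a y-low-in))
      unique (a , _) (inj₂ (refl , _ , _ , _ , inj₂ y≡flip-a)) _ = cong (_, i) (begin
        a                                   ≡⟨ sym (flip-involutive i a) ⟩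
        flipBit (flipBit a (suc i)) (suc i) ≡⟨ cong (λ z → flipBit z (suc i)) (sym y≡flip-a) ⟩
        flipBit y (suc i)                   ≡⟨ flip-involutive i x ⟩
        x                                   ∎)
        where open ≡-Reasoning

  fresh-level : ∀ {i k} → r ≤ i + suc k → ¬ r ≤ i + k → i + suc k ≡ r
  fresh-level {i} {k} r≤ r≰ = ≤-antisym (subst (_≤ r) (sym (+-suc i k)) (≰⇒> r≰)) r≤

  as-step : ∀ {X i k p} → i + suc k ≡ r → NewAt r X i (suc i) p → NewAt r X (r ∸ suc k) (r ∸ k) p
  as-step {X} {i} {k} {p} refl h = subst₂ (λ t s → NewAt r X t s p) t≡ s≡ h
    where
      t≡ : i ≡ i + suc k ∸ suc k
      t≡ = sym (m+n∸n≡m i (suc k))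
      s≡ : suc i ≡ i + suc k ∸ k
      s≡ = trans (cong suc t≡) (sym (source-level (m≤n+m (suc k) i)))

  Xdown-complete : ∀ k → k ≤ r → Covers k
  Xdown-complete zero _ {i} {x} r≤i+0 i≤r x< g with ≤-antisym i≤r (subst (r ≤_) (+-identityʳ i) r≤i+0)
  ... | refl = good-S-top x< g
  Xdown-complete (suc k) sk≤r {i} {x} r≤ i≤r x< g with r ≤? i + k
  ... | yes r≤i+k = inj₁ (Xdown-complete k (≤-trans (n≤1+n k) sk≤r) r≤i+k i≤r x< g)
  ... | no r≰i+k with good⇒seed-or-flip-seed i x g
  ...   | inj₁ seed = inj₁ (S⊆Xdown k (seed-S (≤-trans (s≤s (m≤m+n i k)) (≰⇒> r≰i+k)) x< seed))
  ...   | inj₂ (¬seed , flip-seed) = inj₂ (as-step fresh (forced k i fresh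
            (Xdown-complete k (≤-trans (n≤1+n k) sk≤r)) x< ¬seed flip-seed))
    where fresh = fresh-level r≤ r≰i+k

  Xr-good : ∀ {x i} → Xdown r r (x , i) → Good i x
  Xr-good = Xdown-good r ≤-refl

  good-Xr : ∀ {x i} → i ≤ r → x < 2 ^ r → Good i x → Xdown r r (x , i)
  good-Xr {i = i} = Xdown-complete r ≤-refl (m≤n+m r i)

  -- The second phase fills the levels 0, ..., k after k steps; the new level k+1 is filled
  -- by forcing each non-good (x , k+1) from (x , k), whose partner (x + e_(k+1) , k+1) is good.
  fill : ∀ k → k ≤ r → ∀ {i x} → i ≤ k → x < 2 ^ r → Xup r k (x , i)
  fill-top : ∀ k → suc k ≤ r → ∀ {x} → x < 2 ^ r → Xup r (suc k) (x , suc k)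

  fill zero _ {x = x} z≤n x< = good-Xr z≤n x< (good-zero x)
  fill (suc k) sk≤r {i} i≤sk x< with i ≤? k
  ... | yes i≤k = inj₁ (fill k (≤-trans (n≤1+n k) sk≤r) i≤k x<)
  ... | no i≰k with ≤-antisym i≤sk (≰⇒> i≰k)
  ...   | refl = fill-top k sk≤r x<

  fill-top k sk≤r {x} x< with good? (suc k) x
  ... | yes g = inj₁ (Xdown⊆Xup k (good-Xr sk≤r x< g))
  ... | no ¬g = inj₂ (refl , x , fill k k≤r ≤-refl x< , adj , x-out , unique)
    where
      k≤r = ≤-trans (n≤1+n k) sk≤r
      adj : N r (x , k) (x , suc k)
      adj = inj₁ (refl , sk≤r , x< , x< , inj₁ refl)
      x-out : ¬ Xup r k (x , suc k)
      x-out h = ¬g (Xr-good (Xup-above k (n<1+n k) h))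
      flip-in : Xup r k (flipBit x (suc k) , suc k)
      flip-in with good-or-flip-good k x
      ... | inj₁ g = ⊥-elim (¬g g)
      ... | inj₂ g = Xdown⊆Xup k (good-Xr sk≤r (flip-< k r x sk≤r x<) g)
      unique : ∀ u → N r (x , k) u → ¬ Xup r k u → u ≡ (x , suc k)
      unique _ (inj₁ (refl , _ , _ , _ , inj₁ refl)) _ = refl
      unique _ (inj₁ (refl , _ , _ , _ , inj₂ refl)) u-out = ⊥-elim (u-out flip-in)
      unique (a , j) (inj₂ (sj≡k , _ , a< , _ , _)) u-out =
        ⊥-elim (u-out (fill k k≤r (subst (j ≤_) sj≡k (n≤1+n j)) a<))

open Forcing

lemma3p3 : (r : ℕ) → 1 ≤ r → (k : ℕ) → k ≤ r →
    ((i : ℕ) → i ≤ k → (x : ℕ) → Xup r k (x , i) ⇔ V r i (x , i))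
    × ((i : ℕ) → k < i → i ≤ r → (x : ℕ) → Xup r k (x , i) ⇔ Xdown r r (x , i))
lemma3p3 r _ k k≤r =
    (λ i i≤k x → mk⇔ (λ h → refl , Xup-bounded r k h) (λ v → fill r k k≤r i≤k (proj₂ v)))
  , (λ i k<i i≤r x → mk⇔ (Xup-above r k k<i) (Xdown⊆Xup r k))
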